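{- Let $p$ be an odd prime and $r,m$ positive integers. Then \[ \sum_{\substack{i+j+k=mp^{r}\\ i,j,k\in \mathcal{P}_{p}}}\frac{1}{ijk}=\frac{6}{mp^{r}}\sum_{\substack{1\leq j< l\leq mp^{r}\\ j,\ l,\ l-j\in \mathcal{P}_{p}}}\frac{1}{jl}. \]
   Context: $\mathcal{P}_{n}$ denotes the set of positive integers coprime to $n$; the left sum runs over ordered triples of positive integers $(i,j,k)$, each coprime to $p$, with $i+j+k=mp^r$; the right sum runs over integer pairs $(j,l)$ with $1\le j<l\le mp^r$ and $j$, $l$, $l-j$ all coprime to $p$. -}

module Defs where

open import Data.Nat as ℕ using (ℕ; zero; suc; _∸_; _<?_)
open import Data.Nat.Coprimality using (Coprime; coprime?)
open import Data.Integer using (+_)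
open import Data.Rational using (ℚ; 0ℚ; _/_; _+_; _*_)
open import Data.List using (List; upTo; map; filter; concatMap)
open import Data.Product using (_×_; _,_)
open import Relation.Nullary.Decidable using (_×-dec_)

-- Rational reciprocal of a natural number; only ever applied to positive
-- arguments below (the value at 0 is an irrelevant convention).
inv : ℕ → ℚ
inv zero    = 0ℚ
inv (suc n) = + 1 / suc n

sumℚ : List ℚ → ℚ
sumℚ = Data.List.foldr _+_ 0ℚ

range1 : ℕ → List ℕ
range1 N = map suc (upTo N)

triples : ℕ → ℕ → List (ℕ × ℕ × ℕ)
triples p N =
  filter (λ { (i , j , k) → (coprime? i p ×-dec coprime? j p) ×-dec coprime? k p })
    (concatMap (λ i → concatMap (λ j →
        map (λ k → (i , j , k)) (filter (λ k → ℕ._≟_ (i ℕ.+ j ℕ.+ k) N) (range1 N)))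
      (range1 N)) (range1 N))

pairs : ℕ → ℕ → List (ℕ × ℕ)
pairs p N =
  filter (λ { (j , l) → (coprime? j p ×-dec coprime? l p) ×-dec coprime? (l ∸ j) p })
    (concatMap (λ j → map (λ l → (j , l)) (filter (λ l → j <? l) (range1 N))) (range1 N))

lhsSum : ℕ → ℕ → ℚ
lhsSum p N = sumℚ (map (λ { (i , j , k) → inv i * inv j * inv k }) (triples p N))

rhsSum : ℕ → ℕ → ℚ
rhsSum p N = sumℚ (map (λ { (j , l) → inv j * inv l }) (pairs p N))

module Submission where

-- Write N = m p^r, c x for "x is coprime to p", and call (a , b) admissible
-- when a, b and k = N - a - b all satisfy c.  The left-hand side is the sum
-- of 1/(a b k) over admissible pairs, the right-hand side (with l = a + b and
-- c l = c (N - l), as p ∣ N) the sum of 1/(a (a + b)).  Admissibility is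
-- invariant under (a , b) ↦ (b , a) and (a , b) ↦ (a , k), so the three terms
-- of N/(a b k) = 1/(ab) + 1/(ak) + 1/(bk) sum to the same value U, while
-- 1/(ab) = 1/(a (a+b)) + 1/(b (a+b)) and one more swap give U = 2 rhs.
-- Hence N · lhs = 3 U = 6 rhs.

open import Defs
open import Data.Nat using (ℕ; _^_) renaming (_*_ to _*ℕ_; _≤_ to _≤ℕ_)
open import Data.Nat.Primality using (Prime)
open import Data.Integer using (+_)
open import Data.Rational using (_*_; _/_)
open import Relation.Binary.PropositionalEquality using (_≡_; _≢_)

open import Data.Nat using (zero; suc; pred; ≢-nonZero⁻¹; >-nonZero; nonTrivial⇒nonZero;
  _∸_; _<_; _≟_; _<?_; _≤?_; z≤n; s≤s; NonZero)
  renaming (_+_ to _+ℕ_)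
import Data.Nat.Properties as ℕP
open import Data.Nat.Primality using (prime)
open import Data.Nat.Divisibility using (_∣_; ∣-trans; ∣m+n∣m⇒∣n; m∣m*n; n∣m*n)
open import Data.Nat.Coprimality using (Coprime; coprime?; ¬0-coprimeTo-2+; 1-coprimeTo)
  renaming (sym to coprime-sym)
import Data.Integer as ℤ
import Data.Integer.Properties as ℤP
open import Data.Sign using (Sign)
open import Data.Rational using (ℚ; 0ℚ; 1ℚ; mkℚ; _+_)
import Data.Rational.Properties as ℚP
open import Data.Rational.Solver using (module +-*-Solver)
open +-*-Solver using (solve; _:=_; _:+_; _:*_; con)
open import Data.Bool using (Bool; true; false; if_then_else_; _∧_)
open import Data.Bool.Properties using (∧-assoc; ∧-comm; ∧-zeroʳ)
open import Data.List using (List; []; _∷_; _++_; map; filter; concatMap; applyUpTo; upTo)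
open import Data.Product using (_×_; _,_)
open import Data.Sum using (inj₁; inj₂)
open import Function.Bundles using (mk⇔)
open import Relation.Nullary using (does; yes; no; contradiction)
open import Relation.Nullary.Decidable using (dec-false; does-⇔)
open import Relation.Unary using (Decidable)
open import Relation.Binary.PropositionalEquality using (refl; sym; trans; cong; cong₂; subst; module ≡-Reasoning)

ι : ℕ → ℚ
ι n = + n / 1

ι-+ : ∀ a b → ι (a +ℕ b) ≡ ι a + ι b
ι-+ a b = sym (trans (cong₂ _+_ (ι≡mkℚ a) (ι≡mkℚ b)) (ℚP./-cong numerator refl))
  where
  ι≡mkℚ : ∀ n → ι n ≡ mkℚ (ℤ.+ n) 0 (coprime-sym (1-coprimeTo n))
  ι≡mkℚ n = ℚP.normalize-coprime (coprime-sym (1-coprimeTo n))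
  numerator : (Sign.+ ℤ.◃ (a *ℕ 1)) ℤ.+ (ℤ.+ b ℤ.* ℤ.+ 1) ≡ ℤ.+ (a +ℕ b)
  numerator = cong₂ ℤ._+_ (trans (ℤP.+◃n≡+n (a *ℕ 1)) (cong ℤ.+_ (ℕP.*-identityʳ a)))
                          (ℤP.*-identityʳ (ℤ.+ b))

inv-ι : ∀ n .{{_ : NonZero n}} → inv n * ι n ≡ 1ℚ
inv-ι (suc n)
  rewrite ℚP.normalize-coprime {1} {n} (1-coprimeTo (suc n))
        | ℚP.normalize-coprime {suc n} {0} (coprime-sym (1-coprimeTo (suc n)))
        = ℚP.*-inverseˡ (mkℚ (ℤ.+ suc n) 0 (coprime-sym (1-coprimeTo (suc n))))

partial-fractions₃ : ∀ i j k .{{_ : NonZero i}} .{{_ : NonZero j}} .{{_ : NonZero k}} →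
  ι (i +ℕ j +ℕ k) * (inv i * inv j * inv k) ≡ inv i * inv j + inv i * inv k + inv j * inv k
partial-fractions₃ i j k = begin
    ι (i +ℕ j +ℕ k) * (x * y * z)
  ≡⟨ cong (_* (x * y * z)) (trans (ι-+ (i +ℕ j) k) (cong (_+ ι k) (ι-+ i j))) ⟩
    (ι i + ι j + ι k) * (x * y * z)
  ≡⟨ solve 6 (λ I J K x y z → (I :+ J :+ K) :* (x :* y :* z) :=
        (x :* I) :* (y :* z) :+ (y :* J) :* (x :* z) :+ (z :* K) :* (x :* y)) refl (ι i) (ι j) (ι k) x y z ⟩
    (x * ι i) * (y * z) + (y * ι j) * (x * z) + (z * ι k) * (x * y)
  ≡⟨ cong₂ _+_ (cong₂ _+_ (cong (_* (y * z)) (inv-ι i)) (cong (_* (x * z)) (inv-ι j)))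
               (cong (_* (x * y)) (inv-ι k)) ⟩
    1ℚ * (y * z) + 1ℚ * (x * z) + 1ℚ * (x * y)
  ≡⟨ solve 3 (λ x y z → con 1ℚ :* (y :* z) :+ con 1ℚ :* (x :* z) :+ con 1ℚ :* (x :* y) :=
        x :* y :+ x :* z :+ y :* z) refl x y z ⟩
    x * y + x * z + y * z
  ∎
  where
  open ≡-Reasoning
  x y z : ℚ
  x = inv i
  y = inv j
  z = inv k

partial-fractions₂ : ∀ a b .{{_ : NonZero a}} .{{_ : NonZero b}} →
  inv a * inv (a +ℕ b) + inv b * inv (a +ℕ b) ≡ inv a * inv b
partial-fractions₂ a@(suc _) b = begin
    x * z + y * z
  ≡⟨ solve 3 (λ x y z → x :* z :+ y :* z := con 1ℚ :* (y :* z) :+ con 1ℚ :* (x :* z)) refl x y z ⟩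
    1ℚ * (y * z) + 1ℚ * (x * z)
  ≡⟨ sym (cong₂ _+_ (cong (_* (y * z)) (inv-ι a)) (cong (_* (x * z)) (inv-ι b))) ⟩
    (x * ι a) * (y * z) + (y * ι b) * (x * z)
  ≡⟨ solve 5 (λ A B x y z → (x :* A) :* (y :* z) :+ (y :* B) :* (x :* z) := (x :* y) :* (z :* (A :+ B)))
       refl (ι a) (ι b) x y z ⟩
    (x * y) * (z * (ι a + ι b))
  ≡⟨ cong (λ t → (x * y) * (z * t)) (sym (ι-+ a b)) ⟩
    (x * y) * (z * ι (a +ℕ b))
  ≡⟨ cong ((x * y) *_) (inv-ι (a +ℕ b)) ⟩
    (x * y) * 1ℚ
  ≡⟨ ℚP.*-identityʳ _ ⟩
    x * y
  ∎
  where
  open ≡-Reasoning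
  x y z : ℚ
  x = inv a
  y = inv b
  z = inv (a +ℕ b)

cancel-ι : ∀ n .{{_ : NonZero n}} {x y : ℚ} → ι n * x ≡ y → x ≡ inv n * y
cancel-ι n {x} {y} nx≡y = begin
    x                    ≡⟨ sym (ℚP.*-identityˡ x) ⟩
    1ℚ * x               ≡⟨ cong (_* x) (sym (inv-ι n)) ⟩
    (inv n * ι n) * x    ≡⟨ ℚP.*-assoc (inv n) (ι n) x ⟩
    inv n * (ι n * x)    ≡⟨ cong (inv n *_) nx≡y ⟩
    inv n * y            ∎
  where open ≡-Reasoning

Σ : ℕ → (ℕ → ℚ) → ℚ
Σ zero    f = 0ℚ
Σ (suc n) f = f 1 + Σ n (λ x → f (suc x))

when : Bool → ℚ → ℚ
when b q = if b then q else 0ℚ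

when-cong : ∀ b {q r : ℚ} → (b ≡ true → q ≡ r) → when b q ≡ when b r
when-cong true  q≡r = q≡r refl
when-cong false q≡r = refl

when-+ : ∀ b q r → when b (q + r) ≡ when b q + when b r
when-+ true  q r = refl
when-+ false q r = sym (ℚP.+-identityˡ 0ℚ)

when-* : ∀ b q r → when b (q * r) ≡ q * when b r
when-* true  q r = refl
when-* false q r = sym (ℚP.*-zeroʳ q)

Σ-cong : ∀ n {f g : ℕ → ℚ} → (∀ x → x < n → f (suc x) ≡ g (suc x)) → Σ n f ≡ Σ n g
Σ-cong zero    eq = refl
Σ-cong (suc n) eq = cong₂ _+_ (eq 0 (s≤s z≤n)) (Σ-cong n (λ x x<n → eq (suc x) (s≤s x<n)))

Σ-vanish : ∀ n {f : ℕ → ℚ} → (∀ x → x < n → f (suc x) ≡ 0ℚ) → Σ n f ≡ 0ℚ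
Σ-vanish zero    f≡0 = refl
Σ-vanish (suc n) f≡0 =
  trans (cong₂ _+_ (f≡0 0 (s≤s z≤n)) (Σ-vanish n (λ x x<n → f≡0 (suc x) (s≤s x<n))))
        (ℚP.+-identityˡ 0ℚ)

Σ-+ : ∀ n (f g : ℕ → ℚ) → Σ n (λ x → f x + g x) ≡ Σ n f + Σ n g
Σ-+ zero    f g = sym (ℚP.+-identityˡ 0ℚ)
Σ-+ (suc n) f g = trans (cong (_+_ (f 1 + g 1)) (Σ-+ n (λ x → f (suc x)) (λ x → g (suc x))))
  (solve 4 (λ a b c d → (a :+ b) :+ (c :+ d) := (a :+ c) :+ (b :+ d)) refl (f 1) (g 1) _ _)

Σ-* : ∀ n (q : ℚ) (f : ℕ → ℚ) → Σ n (λ x → q * f x) ≡ q * Σ n f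
Σ-* zero    q f = sym (ℚP.*-zeroʳ q)
Σ-* (suc n) q f = trans (cong (_+_ (q * f 1)) (Σ-* n q (λ x → f (suc x)))) (sym (ℚP.*-distribˡ-+ q _ _))

Σ-swap : ∀ n m (F : ℕ → ℕ → ℚ) → Σ n (λ x → Σ m (F x)) ≡ Σ m (λ y → Σ n (λ x → F x y))
Σ-swap zero    m F = sym (Σ-vanish m (λ _ _ → refl))
Σ-swap (suc n) m F = trans (cong (_+_ (Σ m (F 1))) (Σ-swap n m (λ x → F (suc x))))
  (sym (Σ-+ m (F 1) (λ y → Σ n (λ x → F (suc x) y))))

Σ-snoc : ∀ n (f : ℕ → ℚ) → Σ (suc n) f ≡ Σ n f + f (suc n)
Σ-snoc zero    f = ℚP.+-comm (f 1) 0ℚ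
Σ-snoc (suc n) f = trans (cong (_+_ (f 1)) (Σ-snoc n (λ x → f (suc x)))) (sym (ℚP.+-assoc (f 1) _ _))

Σ-truncate : ∀ n K (f : ℕ → ℚ) → K ≤ℕ n → (∀ x → K < x → x ≤ℕ n → f x ≡ 0ℚ) → Σ n f ≡ Σ K f
Σ-truncate zero    .zero f z≤n vanish = refl
Σ-truncate (suc n) K     f K≤n vanish with ℕP.m≤n⇒m<n∨m≡n K≤n
... | inj₂ refl      = refl
... | inj₁ (s≤s K≤n') = begin
    Σ (suc n) f        ≡⟨ Σ-snoc n f ⟩
    Σ n f + f (suc n)  ≡⟨ cong (_+_ (Σ n f)) (vanish (suc n) (s≤s K≤n') ℕP.≤-refl) ⟩
    Σ n f + 0ℚ         ≡⟨ ℚP.+-identityʳ _ ⟩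
    Σ n f              ≡⟨ Σ-truncate n K f K≤n' (λ x K<x x≤n → vanish x K<x (ℕP.m≤n⇒m≤1+n x≤n)) ⟩
    Σ K f              ∎
  where open ≡-Reasoning

Σ-reverse : ∀ n (f : ℕ → ℚ) → Σ n f ≡ Σ n (λ x → f (suc n ∸ x))
Σ-reverse zero    f = refl
Σ-reverse (suc n) f = begin
    f 1 + Σ n (λ x → f (suc x))
  ≡⟨ cong (_+_ (f 1)) (Σ-reverse n (λ x → f (suc x))) ⟩
    f 1 + Σ n (λ x → f (suc (suc n ∸ x)))
  ≡⟨ cong (_+_ (f 1)) (Σ-cong n (λ x x<n → cong f (sym (ℕP.+-∸-assoc 1 (ℕP.≤-trans x<n (ℕP.n≤1+n n)))))) ⟩
    f 1 + Σ n (λ x → f (suc (suc n) ∸ x))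
  ≡⟨ ℚP.+-comm (f 1) _ ⟩
    Σ n (λ x → f (suc (suc n) ∸ x)) + f 1
  ≡⟨ cong (λ t → Σ n (λ x → f (suc (suc n) ∸ x)) + f t) (sym (ℕP.m+n∸n≡m 1 n)) ⟩
    Σ n (λ x → f (suc (suc n) ∸ x)) + f (suc (suc n) ∸ suc n)
  ≡⟨ sym (Σ-snoc n (λ x → f (suc (suc n) ∸ x))) ⟩
    Σ (suc n) (λ x → f (suc (suc n) ∸ x))
  ∎
  where open ≡-Reasoning

Σ-reflect : ∀ n s (g : ℕ → ℚ) → s ≤ℕ n → g 0 ≡ 0ℚ → (∀ x → s ≤ℕ x → g x ≡ 0ℚ) →
  Σ n g ≡ Σ n (λ x → g (s ∸ x))
Σ-reflect n zero    g _   g0≡0 vanish =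
  trans (Σ-vanish n (λ x _ → vanish (suc x) z≤n)) (sym (Σ-vanish n (λ _ _ → g0≡0)))
Σ-reflect n (suc t) g s≤n g0≡0 vanish = begin
    Σ n g                        ≡⟨ Σ-truncate n t g t≤n (λ x t<x _ → vanish x t<x) ⟩
    Σ t g                        ≡⟨ Σ-reverse t g ⟩
    Σ t (λ x → g (suc t ∸ x))    ≡⟨ sym (Σ-truncate n t (λ x → g (suc t ∸ x)) t≤n reflected-vanish) ⟩
    Σ n (λ x → g (suc t ∸ x))    ∎
  where
  open ≡-Reasoning
  t≤n : t ≤ℕ n
  t≤n = ℕP.≤-trans (ℕP.n≤1+n t) s≤n
  reflected-vanish : ∀ x → t < x → x ≤ℕ n → g (suc t ∸ x) ≡ 0ℚ
  reflected-vanish x t<x _ = trans (cong g (ℕP.m≤n⇒m∸n≡0 t<x)) g0≡0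

Σ-delta-suc : ∀ n t (f : ℕ → ℚ) → t < n → Σ n (λ k → when (does (k ≟ suc t)) (f k)) ≡ f (suc t)
Σ-delta-suc (suc n) zero    f _ =
  trans (cong (_+_ (f 1)) (Σ-vanish n (λ _ _ → refl))) (ℚP.+-identityʳ (f 1))
Σ-delta-suc (suc n) (suc t) f (s≤s t<n) =
  trans (ℚP.+-identityˡ _) (Σ-delta-suc n t (λ x → f (suc x)) t<n)

Σ-delta : ∀ n t (f : ℕ → ℚ) → t ≤ℕ n → f 0 ≡ 0ℚ → Σ n (λ k → when (does (k ≟ t)) (f k)) ≡ f t
Σ-delta n zero    f _   f0≡0 = trans (Σ-vanish n (λ _ _ → refl)) (sym f0≡0)
Σ-delta n (suc t) f t<n _    = Σ-delta-suc n t f t<n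

Σ-shift : ∀ j n (f : ℕ → ℚ) → Σ n (λ l → when (does (j <? l)) (f l)) ≡ Σ (n ∸ j) (λ b → f (j +ℕ b))
Σ-shift zero    n       f = Σ-cong n (λ _ _ → refl)
Σ-shift (suc j) zero    f = refl
Σ-shift (suc j) (suc n) f = trans (ℚP.+-identityˡ _) (Σ-shift j n (λ x → f (suc x)))

≟-shift : ∀ m k n → does (m +ℕ suc k ≟ n) ≡ does (suc k ≟ n ∸ m)
≟-shift zero    k n       = refl
≟-shift (suc m) k zero    = refl
≟-shift (suc m) k (suc n) = ≟-shift m k n

sumOver : {A : Set} → List A → (A → ℚ) → ℚ
sumOver xs f = sumℚ (map f xs)

sumOver-++ : {A : Set} (xs ys : List A) (f : A → ℚ) →
  sumOver (xs ++ ys) f ≡ sumOver xs f + sumOver ys f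
sumOver-++ []       ys f = sym (ℚP.+-identityˡ _)
sumOver-++ (x ∷ xs) ys f = trans (cong (_+_ (f x)) (sumOver-++ xs ys f)) (sym (ℚP.+-assoc (f x) _ _))

sumOver-concatMap : {A B : Set} (h : A → List B) (xs : List A) (f : B → ℚ) →
  sumOver (concatMap h xs) f ≡ sumOver xs (λ x → sumOver (h x) f)
sumOver-concatMap h []       f = refl
sumOver-concatMap h (x ∷ xs) f =
  trans (sumOver-++ (h x) (concatMap h xs) f) (cong (_+_ (sumOver (h x) f)) (sumOver-concatMap h xs f))

sumOver-map : {A B : Set} (g : A → B) (xs : List A) (f : B → ℚ) →
  sumOver (map g xs) f ≡ sumOver xs (λ x → f (g x))
sumOver-map g []       f = refl
sumOver-map g (x ∷ xs) f = cong (_+_ (f (g x))) (sumOver-map g xs f)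

sumOver-filter : {A : Set} {P : A → Set} (P? : Decidable P) (xs : List A) (f : A → ℚ) →
  sumOver (filter P? xs) f ≡ sumOver xs (λ x → when (does (P? x)) (f x))
sumOver-filter P? []       f = refl
sumOver-filter P? (x ∷ xs) f with does (P? x)
... | true  = cong (_+_ (f x)) (sumOver-filter P? xs f)
... | false = trans (sumOver-filter P? xs f) (sym (ℚP.+-identityˡ _))

sumOver-applyUpTo : ∀ (h : ℕ → ℕ) n (f : ℕ → ℚ) →
  sumOver (applyUpTo (λ x → h (suc x)) n) f ≡ Σ n (λ x → f (h x))
sumOver-applyUpTo h zero    f = refl
sumOver-applyUpTo h (suc n) f = cong (_+_ (f (h 1))) (sumOver-applyUpTo (λ x → h (suc x)) n f)

sumOver-range : ∀ n (f : ℕ → ℚ) → sumOver (range1 n) f ≡ Σ n f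
sumOver-range n f = begin
    sumOver (map suc (upTo n)) f                 ≡⟨ sumOver-map suc (upTo n) f ⟩
    sumOver (upTo n) (λ x → f (suc x))           ≡⟨ sumOver-applyUpTo pred n (λ x → f (suc x)) ⟩
    Σ n (λ x → f (suc (pred x)))               ≡⟨ Σ-cong n (λ _ _ → refl) ⟩
    Σ n f                                        ∎
  where open ≡-Reasoning

sumOver-concatMap-range : ∀ {B : Set} n (h : ℕ → List B) (f : B → ℚ) →
  sumOver (concatMap h (range1 n)) f ≡ Σ n (λ x → sumOver (h x) f)
sumOver-concatMap-range n h f =
  trans (sumOver-concatMap h (range1 n) f) (sumOver-range n (λ x → sumOver (h x) f))

sumOver-filter-range : ∀ n {P : ℕ → Set} (P? : Decidable P) (f : ℕ → ℚ) →
  sumOver (filter P? (range1 n)) f ≡ Σ n (λ x → when (does (P? x)) (f x))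
sumOver-filter-range n P? f = trans (sumOver-filter P? (range1 n) f) (sumOver-range n _)

sumOver-triples : ∀ n {P : ℕ × ℕ × ℕ → Set} (P? : Decidable P)
  {E : ℕ → ℕ → ℕ → Set} (E? : ∀ i j → Decidable (E i j)) (g : ℕ × ℕ × ℕ → ℚ) →
  sumOver (filter P? (concatMap (λ i → concatMap (λ j →
      map (λ k → (i , j , k)) (filter (E? i j) (range1 n))) (range1 n)) (range1 n))) g
  ≡ Σ n (λ i → Σ n (λ j → Σ n (λ k →
      when (does (E? i j k)) (when (does (P? (i , j , k))) (g (i , j , k))))))
sumOver-triples n {P} P? {E} E? g = begin
    sumOver (filter P? (concatMap row R)) g
  ≡⟨ sumOver-filter P? (concatMap row R) g ⟩
    sumOver (concatMap row R) G
  ≡⟨ sumOver-concatMap-range n row G ⟩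
    Σ n (λ i → sumOver (row i) G)
  ≡⟨ Σ-cong n (λ i _ → sumOver-concatMap-range n (column (suc i)) G) ⟩
    Σ n (λ i → Σ n (λ j → sumOver (column i j) G))
  ≡⟨ Σ-cong n (λ i _ → Σ-cong n (λ j _ → fibre (suc i) (suc j))) ⟩
    Σ n (λ i → Σ n (λ j → Σ n (λ k → when (does (E? i j k)) (G (i , j , k)))))
  ∎
  where
  open ≡-Reasoning
  R : List ℕ
  R = range1 n
  G : ℕ × ℕ × ℕ → ℚ
  G t = when (does (P? t)) (g t)
  column : ℕ → ℕ → List (ℕ × ℕ × ℕ)
  column i j = map (λ k → (i , j , k)) (filter (E? i j) R)
  row : ℕ → List (ℕ × ℕ × ℕ)
  row i = concatMap (column i) R
  fibre : ∀ i j → sumOver (column i j) G ≡ Σ n (λ k → when (does (E? i j k)) (G (i , j , k)))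
  fibre i j = trans (sumOver-map (λ k → (i , j , k)) (filter (E? i j) R) G)
                    (sumOver-filter-range n (E? i j) (λ k → G (i , j , k)))

sumOver-pairs : ∀ n {P : ℕ × ℕ → Set} (P? : Decidable P)
  {E : ℕ → ℕ → Set} (E? : ∀ j → Decidable (E j)) (g : ℕ × ℕ → ℚ) →
  sumOver (filter P? (concatMap (λ j → map (λ l → (j , l)) (filter (E? j) (range1 n))) (range1 n))) g
  ≡ Σ n (λ j → Σ n (λ l → when (does (E? j l)) (when (does (P? (j , l))) (g (j , l)))))
sumOver-pairs n {P} P? {E} E? g = begin
    sumOver (filter P? (concatMap row R)) g
  ≡⟨ sumOver-filter P? (concatMap row R) g ⟩
    sumOver (concatMap row R) G
  ≡⟨ sumOver-concatMap-range n row G ⟩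
    Σ n (λ j → sumOver (row j) G)
  ≡⟨ Σ-cong n (λ j _ → fibre (suc j)) ⟩
    Σ n (λ j → Σ n (λ l → when (does (E? j l)) (G (j , l))))
  ∎
  where
  open ≡-Reasoning
  R : List ℕ
  R = range1 n
  G : ℕ × ℕ → ℚ
  G t = when (does (P? t)) (g t)
  row : ℕ → List (ℕ × ℕ)
  row j = map (λ l → (j , l)) (filter (E? j) R)
  fibre : ∀ j → sumOver (row j) G ≡ Σ n (λ l → when (does (E? j l)) (G (j , l)))
  fibre j = trans (sumOver-map (λ l → (j , l)) (filter (E? j) R) G)
                  (sumOver-filter-range n (E? j) (λ l → G (j , l)))

coprimeTo : ℕ → ℕ → Bool
coprimeTo p x = does (coprime? x p)

lhsSum-as-Σ : ∀ p N → lhsSum p N ≡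
  Σ N (λ i → Σ N (λ j → Σ N (λ k → when (does (i +ℕ j +ℕ k ≟ N))
    (when ((coprimeTo p i ∧ coprimeTo p j) ∧ coprimeTo p k) (inv i * inv j * inv k)))))
lhsSum-as-Σ p N = sumOver-triples N _ (λ i j k → i +ℕ j +ℕ k ≟ N) _

rhsSum-as-Σ : ∀ p N → rhsSum p N ≡
  Σ N (λ j → Σ N (λ l → when (does (j <? l))
    (when ((coprimeTo p j ∧ coprimeTo p l) ∧ coprimeTo p (l ∸ j)) (inv j * inv l))))
rhsSum-as-Σ p N = sumOver-pairs N _ (λ j l → j <? l) _

∧-swapʳ : ∀ x y z → (x ∧ y) ∧ z ≡ (x ∧ z) ∧ y
∧-swapʳ x y z = trans (∧-assoc x y z) (trans (cong (x ∧_) (∧-comm y z)) (sym (∧-assoc x z y)))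

∧-true : ∀ x y → x ∧ y ≡ true → x ≡ true × y ≡ true
∧-true true true refl = refl , refl

module Admissible (N : ℕ) (c : ℕ → Bool) (c0 : c 0 ≡ false) where

  admissible : ℕ → ℕ → Bool
  admissible a b = (c a ∧ c b) ∧ c (N ∸ (a +ℕ b))

  Ξ : (ℕ → ℕ → ℚ) → ℚ
  Ξ f = Σ N (λ a → Σ N (λ b → when (admissible a b) (f a b)))

  c-nonZero : ∀ {x} → c x ≡ true → NonZero x
  c-nonZero {zero}  cx = contradiction (trans (sym cx) c0) (λ ())
  c-nonZero {suc x} _  = _

  admissible-nonZero : ∀ a b → admissible a b ≡ true →
    NonZero a × NonZero b × NonZero (N ∸ (a +ℕ b))
  admissible-nonZero a b adm with ∧-true (c a ∧ c b) _ adm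
  ... | cab , ck with ∧-true (c a) (c b) cab
  ...   | ca , cb = c-nonZero ca , c-nonZero cb , c-nonZero ck

  admissible-second-zero : ∀ a → admissible a 0 ≡ false
  admissible-second-zero a rewrite c0 | ∧-zeroʳ (c a) = refl

  admissible-complement-zero : ∀ a b → N ∸ (a +ℕ b) ≡ 0 → admissible a b ≡ false
  admissible-complement-zero a b k≡0 rewrite k≡0 | c0 = ∧-zeroʳ (c a ∧ c b)

  admissible-sym : ∀ a b → admissible a b ≡ admissible b a
  admissible-sym a b = cong₂ _∧_ (∧-comm (c a) (c b)) (cong (λ x → c (N ∸ x)) (ℕP.+-comm a b))

  admissible-reflect : ∀ a b → admissible a (N ∸ (a +ℕ b)) ≡ admissible a b
  admissible-reflect a b with b ≤? N ∸ a
  ... | yes b≤N∸a = begin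
      (c a ∧ c k) ∧ c (N ∸ (a +ℕ k))  ≡⟨ cong (λ x → (c a ∧ c k) ∧ c x) complement ⟩
      (c a ∧ c k) ∧ c b               ≡⟨ ∧-swapʳ (c a) (c k) (c b) ⟩
      (c a ∧ c b) ∧ c k               ∎
    where
    open ≡-Reasoning
    k : ℕ
    k = N ∸ (a +ℕ b)
    complement : N ∸ (a +ℕ k) ≡ b
    complement = begin
      N ∸ (a +ℕ k)            ≡⟨ sym (ℕP.∸-+-assoc N a k) ⟩
      N ∸ a ∸ k               ≡⟨ cong (N ∸ a ∸_) (sym (ℕP.∸-+-assoc N a b)) ⟩
      N ∸ a ∸ (N ∸ a ∸ b)     ≡⟨ ℕP.m∸[m∸n]≡n b≤N∸a ⟩
      b                       ∎
  ... | no b≰N∸a = begin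
      admissible a (N ∸ (a +ℕ b))  ≡⟨ cong (admissible a) k≡0 ⟩
      admissible a 0               ≡⟨ admissible-second-zero a ⟩
      false                        ≡⟨ sym (admissible-complement-zero a b k≡0) ⟩
      admissible a b               ∎
    where
    open ≡-Reasoning
    k≡0 : N ∸ (a +ℕ b) ≡ 0
    k≡0 = trans (sym (ℕP.∸-+-assoc N a b)) (ℕP.m≤n⇒m∸n≡0 (ℕP.<⇒≤ (ℕP.≰⇒> b≰N∸a)))

  Ξ-cong : ∀ {f g : ℕ → ℕ → ℚ} → (∀ a b → admissible a b ≡ true → f a b ≡ g a b) → Ξ f ≡ Ξ g
  Ξ-cong f≡g = Σ-cong N (λ a _ → Σ-cong N (λ b _ →
    when-cong (admissible (suc a) (suc b)) (f≡g (suc a) (suc b))))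

  Ξ-+ : ∀ (f g : ℕ → ℕ → ℚ) → Ξ (λ a b → f a b + g a b) ≡ Ξ f + Ξ g
  Ξ-+ f g = trans (Σ-cong N (λ a _ →
      trans (Σ-cong N (λ b _ → when-+ (admissible (suc a) (suc b)) _ _)) (Σ-+ N _ _)))
    (Σ-+ N _ _)

  Ξ-* : ∀ q (f : ℕ → ℕ → ℚ) → Ξ (λ a b → q * f a b) ≡ q * Ξ f
  Ξ-* q f = trans (Σ-cong N (λ a _ →
      trans (Σ-cong N (λ b _ → when-* (admissible (suc a) (suc b)) q _)) (Σ-* N q _)))
    (Σ-* N q _)

  Ξ-swap : ∀ (f : ℕ → ℕ → ℚ) → Ξ f ≡ Ξ (λ a b → f b a)
  Ξ-swap f = trans (Σ-swap N N _) (Σ-cong N (λ a _ → Σ-cong N (λ b _ →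
    cong (λ t → when t (f (suc b) (suc a))) (admissible-sym (suc b) (suc a)))))

  Ξ-reflect : ∀ (f : ℕ → ℕ → ℚ) → Ξ f ≡ Ξ (λ a b → f a (N ∸ (a +ℕ b)))
  Ξ-reflect f = Σ-cong N (λ a _ → reflect-row (suc a))
    where
    reflect-row : ∀ a → Σ N (λ b → when (admissible a b) (f a b))
                      ≡ Σ N (λ b → when (admissible a b) (f a (N ∸ (a +ℕ b))))
    reflect-row a = begin
        Σ N g                       ≡⟨ Σ-reflect N (N ∸ a) g (ℕP.m∸n≤m N a) g0≡0 beyond ⟩
        Σ N (λ b → g (N ∸ a ∸ b))   ≡⟨ Σ-cong N (λ b _ → reflected (suc b)) ⟩
        Σ N (λ b → when (admissible a b) (f a (N ∸ (a +ℕ b))))  ∎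
      where
      open ≡-Reasoning
      g : ℕ → ℚ
      g b = when (admissible a b) (f a b)
      g0≡0 : g 0 ≡ 0ℚ
      g0≡0 = cong (λ t → when t (f a 0)) (admissible-second-zero a)
      beyond : ∀ b → N ∸ a ≤ℕ b → g b ≡ 0ℚ
      beyond b N∸a≤b = cong (λ t → when t (f a b))
        (admissible-complement-zero a b (trans (sym (ℕP.∸-+-assoc N a b)) (ℕP.m≤n⇒m∸n≡0 N∸a≤b)))
      reflected : ∀ b → g (N ∸ a ∸ b) ≡ when (admissible a b) (f a (N ∸ (a +ℕ b)))
      reflected b rewrite ℕP.∸-+-assoc N a b =
        cong (λ t → when t (f a (N ∸ (a +ℕ b)))) (admissible-reflect a b)

  L U V : ℚ
  L = Ξ (λ a b → inv a * inv b * inv (N ∸ (a +ℕ b)))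
  U = Ξ (λ a b → inv a * inv b)
  V = Ξ (λ a b → inv a * inv (a +ℕ b))

  -- N · L = 3 U: split N/(abk) into three fractions, each of which sums to U.
  N*L≡3U : ι N * L ≡ U + U + U
  N*L≡3U = begin
      ι N * L                                 ≡⟨ sym (Ξ-* (ι N) abk) ⟩
      Ξ (λ a b → ι N * abk a b)               ≡⟨ Ξ-cong split ⟩
      Ξ (λ a b → ab a b + ak a b + bk a b)    ≡⟨ trans (Ξ-+ (λ a b → ab a b + ak a b) bk)
                                                       (cong (_+ Ξ bk) (Ξ-+ ab ak)) ⟩
      U + Ξ ak + Ξ bk                         ≡⟨ cong₂ (λ x y → U + x + y) ak≡U bk≡U ⟩
      U + U + U                               ∎
    where
    open ≡-Reasoning
    k : ℕ → ℕ → ℕ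
    k a b = N ∸ (a +ℕ b)
    abk ab ak bk : ℕ → ℕ → ℚ
    abk a b = inv a * inv b * inv (k a b)
    ab a b = inv a * inv b
    ak a b = inv a * inv (k a b)
    bk a b = inv b * inv (k a b)
    split : ∀ a b → admissible a b ≡ true → ι N * abk a b ≡ ab a b + ak a b + bk a b
    split a b adm with admissible-nonZero a b adm
    ... | nz-a , nz-b , nz-k =
      subst (λ M → ι M * abk a b ≡ ab a b + ak a b + bk a b) a+b+k≡N
        (partial-fractions₃ a b (k a b) {{nz-a}} {{nz-b}} {{nz-k}})
      where
      a+b+k≡N : a +ℕ b +ℕ k a b ≡ N
      a+b+k≡N = ℕP.m+[n∸m]≡n {a +ℕ b} (ℕP.<⇒≤ (ℕP.m∸n≢0⇒n<m (≢-nonZero⁻¹ (k a b) {{nz-k}})))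
    ak≡U : Ξ ak ≡ U
    ak≡U = sym (Ξ-reflect ab)
    bk≡U : Ξ bk ≡ U
    bk≡U = trans (Ξ-swap bk) (trans (Ξ-cong (λ a b _ → cong (λ x → inv a * inv (N ∸ x)) (ℕP.+-comm b a))) ak≡U)

  -- U = 2 V: split 1/(ab) = 1/(a(a+b)) + 1/(b(a+b)) and swap in the second part.
  U≡2V : U ≡ V + V
  U≡2V = begin
      U
    ≡⟨ Ξ-cong split ⟩
      Ξ (λ a b → inv a * inv (a +ℕ b) + inv b * inv (a +ℕ b))
    ≡⟨ Ξ-+ _ _ ⟩
      V + Ξ (λ a b → inv b * inv (a +ℕ b))
    ≡⟨ cong (_+_ V) (trans (Ξ-swap _) (Ξ-cong (λ a b _ → cong (λ x → inv a * inv x) (ℕP.+-comm b a)))) ⟩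
      V + V
    ∎
    where
    open ≡-Reasoning
    split : ∀ a b → admissible a b ≡ true → inv a * inv b ≡ inv a * inv (a +ℕ b) + inv b * inv (a +ℕ b)
    split a b adm with admissible-nonZero a b adm
    ... | nz-a , nz-b , _ = sym (partial-fractions₂ a b {{nz-a}} {{nz-b}})

  N*L≡6V : ι N * L ≡ (V + V) + (V + V) + (V + V)
  N*L≡6V = trans N*L≡3U (cong (λ u → u + u + u) U≡2V)

  -- The triple sum of the left-hand side: the constraint i + j + k = N fixes k.
  triple-sum≡L : Σ N (λ i → Σ N (λ j → Σ N (λ k → when (does (i +ℕ j +ℕ k ≟ N))
                   (when ((c i ∧ c j) ∧ c k) (inv i * inv j * inv k))))) ≡ L
  triple-sum≡L = Σ-cong N (λ i _ → Σ-cong N (λ j _ → collapse (suc i) (suc j)))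
    where
    F : ℕ → ℕ → ℕ → ℚ
    F i j k = when ((c i ∧ c j) ∧ c k) (inv i * inv j * inv k)
    F-zero : ∀ i j → F i j 0 ≡ 0ℚ
    F-zero i j = cong (λ t → when t (inv i * inv j * inv 0))
                      (trans (cong ((c i ∧ c j) ∧_) c0) (∧-zeroʳ (c i ∧ c j)))
    collapse : ∀ i j → Σ N (λ k → when (does (i +ℕ j +ℕ k ≟ N)) (F i j k)) ≡ F i j (N ∸ (i +ℕ j))
    collapse i j =
      trans (Σ-cong N (λ k _ → cong (λ t → when t (F i j (suc k))) (≟-shift (i +ℕ j) k N)))
            (Σ-delta N (N ∸ (i +ℕ j)) (F i j) (ℕP.m∸n≤m N (i +ℕ j)) (F-zero i j))

  -- If moreover c is invariant under x ↦ N - x, the pair sum of the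
  -- right-hand side is V: substitute l = j + b, and c l = c (N - j - b).
  module _ (c-complement : ∀ x → x ≤ℕ N → c (N ∸ x) ≡ c x) where

    pair-sum≡V : Σ N (λ j → Σ N (λ l → when (does (j <? l))
                   (when ((c j ∧ c l) ∧ c (l ∸ j)) (inv j * inv l)))) ≡ V
    pair-sum≡V = Σ-cong N (λ j j<N → row (suc j) j<N)
      where
      row : ∀ j → j ≤ℕ N →
        Σ N (λ l → when (does (j <? l)) (when ((c j ∧ c l) ∧ c (l ∸ j)) (inv j * inv l)))
        ≡ Σ N (λ b → when (admissible j b) (inv j * inv (j +ℕ b)))
      row j j≤N = begin
          Σ N (λ l → when (does (j <? l)) (when ((c j ∧ c l) ∧ c (l ∸ j)) (inv j * inv l)))
        ≡⟨ Σ-shift j N _ ⟩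
          Σ (N ∸ j) (λ b → when ((c j ∧ c (j +ℕ b)) ∧ c (j +ℕ b ∸ j)) (inv j * inv (j +ℕ b)))
        ≡⟨ Σ-cong (N ∸ j) (λ b b<N∸j → cong (λ t → when t (inv j * inv (j +ℕ suc b))) (relabel (suc b) b<N∸j)) ⟩
          Σ (N ∸ j) (λ b → when (admissible j b) (inv j * inv (j +ℕ b)))
        ≡⟨ sym (Σ-truncate N (N ∸ j) _ (ℕP.m∸n≤m N j) beyond) ⟩
          Σ N (λ b → when (admissible j b) (inv j * inv (j +ℕ b)))
        ∎
        where
        open ≡-Reasoning
        relabel : ∀ b → b ≤ℕ N ∸ j → (c j ∧ c (j +ℕ b)) ∧ c (j +ℕ b ∸ j) ≡ admissible j b
        relabel b b≤N∸j = begin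
            (c j ∧ c (j +ℕ b)) ∧ c (j +ℕ b ∸ j)
          ≡⟨ cong₂ (λ x y → (c j ∧ x) ∧ y) (sym (c-complement (j +ℕ b) j+b≤N)) (cong c (ℕP.m+n∸m≡n j b)) ⟩
            (c j ∧ c (N ∸ (j +ℕ b))) ∧ c b
          ≡⟨ ∧-swapʳ (c j) _ (c b) ⟩
            admissible j b
          ∎
          where
          j+b≤N : j +ℕ b ≤ℕ N
          j+b≤N = ℕP.≤-trans (ℕP.+-monoʳ-≤ j b≤N∸j) (ℕP.≤-reflexive (ℕP.m+[n∸m]≡n j≤N))
        beyond : ∀ b → N ∸ j < b → b ≤ℕ N → when (admissible j b) (inv j * inv (j +ℕ b)) ≡ 0ℚ
        beyond b N∸j<b _ = cong (λ t → when t (inv j * inv (j +ℕ b))) (admissible-complement-zero j b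
          (trans (sym (ℕP.∸-+-assoc N j b)) (ℕP.m≤n⇒m∸n≡0 (ℕP.<⇒≤ N∸j<b))))

coprimeTo-zero : ∀ {p} → Prime p → coprimeTo p 0 ≡ false
coprimeTo-zero {p} (prime _) = dec-false (coprime? 0 p) ¬0-coprimeTo-2+

coprime-complement : ∀ {p N x} → p ∣ N → x ≤ℕ N → Coprime (N ∸ x) p → Coprime x p
coprime-complement {p} {N} {x} p∣N x≤N cop {d} (d∣x , d∣p) = cop (d∣N∸x , d∣p)
  where
  d∣N∸x : d ∣ N ∸ x
  d∣N∸x = ∣m+n∣m⇒∣n (subst (d ∣_) (sym (ℕP.m+[n∸m]≡n x≤N)) (∣-trans d∣p p∣N)) d∣x

coprimeTo-complement : ∀ {p N} → p ∣ N → ∀ x → x ≤ℕ N → coprimeTo p (N ∸ x) ≡ coprimeTo p x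
coprimeTo-complement {p} {N} p∣N x x≤N =
  does-⇔ (mk⇔ (coprime-complement p∣N x≤N) from) (coprime? (N ∸ x) p) (coprime? x p)
  where
  from : Coprime x p → Coprime (N ∸ x) p
  from cop = coprime-complement p∣N (ℕP.m∸n≤m N x)
               (subst (λ y → Coprime y p) (sym (ℕP.m∸[m∸n]≡n x≤N)) cop)

lhs≡6/N*rhs : ∀ p N .{{_ : NonZero N}} → Prime p → p ∣ N →
  lhsSum p N ≡ ((+ 6 / 1) * inv N) * rhsSum p N
lhs≡6/N*rhs p N pr p∣N = begin
    lhsSum p N
  ≡⟨ trans (lhsSum-as-Σ p N) triple-sum≡L ⟩
    L
  ≡⟨ cancel-ι N N*L≡6V ⟩
    inv N * ((V + V) + (V + V) + (V + V))
  ≡⟨ solve 2 (λ x v → x :* ((v :+ v) :+ (v :+ v) :+ (v :+ v)) := (con (+ 6 / 1) :* x) :* v) refl (inv N) V ⟩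
    ((+ 6 / 1) * inv N) * V
  ≡⟨ cong (((+ 6 / 1) * inv N) *_) (sym (trans (rhsSum-as-Σ p N) (pair-sum≡V (coprimeTo-complement p∣N)))) ⟩
    ((+ 6 / 1) * inv N) * rhsSum p N
  ∎
  where
  open ≡-Reasoning
  open Admissible N (coprimeTo p) (coprimeTo-zero pr)

-- The paper's statement, N = m p^r with r ≥ 1.
lemma2 : (p r m : ℕ) → Prime p → p ≢ 2 → 1 ≤ℕ r → 1 ≤ℕ m →
    lhsSum p (m *ℕ p ^ r) ≡ ((+ 6 / 1) * inv (m *ℕ p ^ r)) * rhsSum p (m *ℕ p ^ r)
lemma2 p zero    m _ _ () _
lemma2 p (suc r) m pr@(prime _) _ _ m≥1 = lhs≡6/N*rhs p (m *ℕ p ^ suc r) {{N≢0}} pr p∣N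
  where
  N≢0 : NonZero (m *ℕ p ^ suc r)
  N≢0 = >-nonZero (ℕP.*-mono-≤ m≥1 (ℕP.m^n>0 p {{nonTrivial⇒nonZero p}} (suc r)))
  p∣N : p ∣ m *ℕ p ^ suc r
  p∣N = ∣-trans (m∣m*n (p ^ r)) (n∣m*n m)
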